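{- Let $\Lambda$ be a numerical semigroup with enumeration $\lambda$, and let $g(i)=\lambda_i-i$ for $i\in\mathbb{N}_0$. If $i\in\mathbb{N}_0$ satisfies $g(i)<i$, then $\lambda_{i+1}=\lambda_i+1$.
   Context: A numerical semigroup is a subset $\Lambda\subseteq\mathbb{N}_0$ containing $0$, closed under addition, with finite complement in $\mathbb{N}_0$. Its enumeration is the unique increasing bijection $\lambda:\mathbb{N}_0\to\Lambda$, written $\lambda_i=\lambda(i)$. The quantity $g(i)=\lambda_i-i$ (the $i$th partial genus) equals the number of elements of $\mathbb{N}_0\setminus\Lambda$ smaller than $\lambda_i$. -}

module Defs where

open import Data.Nat using (ℕ; zero; suc; _+_; _∸_; _≤_; _<_)
open import Data.Product using (Σ; ∃; _×_)
open import Relation.Binary.PropositionalEquality using (_≡_)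

record IsNumericalSemigroup (Λ : ℕ → Set) : Set where
  field
    zero∈     : Λ 0
    +-closed  : ∀ {m n} → Λ m → Λ n → Λ (m + n)
    cofinite  : ∃ λ N → ∀ n → N ≤ n → Λ n

record IsEnumeration (Λ : ℕ → Set) (e : ℕ → ℕ) : Set where
  field
    increasing : ∀ {i j} → i < j → e i < e j
    into       : ∀ i → Λ (e i)
    onto       : ∀ n → Λ n → ∃ λ i → e i ≡ n

-- i-th partial genus g(i) = λ_i - i  (truncated subtraction; λ_i ≥ i always holds).
partialGenus : (ℕ → ℕ) → ℕ → ℕ
partialGenus e i = e i ∸ i

-- Suppose λᵢ + 1 ∉ Λ. Besides λ₀ < ⋯ < λᵢ, the interval [0, λᵢ] contains the
-- i distinct numbers λᵢ + 1 − λⱼ (1 ≤ j ≤ i), and none of them lies in Λ,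
-- since λⱼ + (λᵢ + 1 − λⱼ) = λᵢ + 1. Hence 2i + 1 ≤ λᵢ + 1, i.e. g(i) ≥ i.
-- So g(i) < i forces λᵢ + 1 ∈ Λ, and then λᵢ₊₁ = λᵢ + 1.
module Submission where

open import Defs
open import Data.Nat using (ℕ; suc; _+_; _<_)
open import Relation.Binary.PropositionalEquality using (_≡_)

open import Data.Nat using (_∸_; _≤_; z≤n; s≤s; s≤s⁻¹; z<s; _≟_)
open import Data.Nat.Properties
open import Data.Fin using (Fin; toℕ; splitAt; join)
open import Data.Fin.Properties
  using (toℕ<n; toℕ-injective; fromℕ<-injective; injective⇒≤; join-splitAt)
open import Data.Product using (_,_)
open import Data.Sum using (inj₁; inj₂; [_,_]′)
open import Function using (_∘_)
open import Function.Definitions using (Injective)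
open import Relation.Binary.Definitions using (Monotonic₁; tri<; tri≈; tri>)
open import Relation.Binary.PropositionalEquality using (refl; sym; trans; cong; subst; module ≡-Reasoning)
open import Relation.Nullary using (¬_; yes; no; contradiction)

module _ {f : ℕ → ℕ} (f-mono : Monotonic₁ _<_ _<_ f) where

  <-mono⇒≤-mono : Monotonic₁ _≤_ _≤_ f
  <-mono⇒≤-mono m≤n with m≤n⇒m<n∨m≡n m≤n
  ... | inj₁ m<n  = <⇒≤ (f-mono m<n)
  ... | inj₂ refl = ≤-refl

  <-mono⇒cancel-< : ∀ {m n} → f m < f n → m < n
  <-mono⇒cancel-< fm<fn = ≰⇒> (λ n≤m → <⇒≱ fm<fn (<-mono⇒≤-mono n≤m))

  <-mono⇒injective : Injective _≡_ _≡_ f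
  <-mono⇒injective {m} {n} fm≡fn with <-cmp m n
  ... | tri< m<n _ _ = contradiction fm≡fn (<⇒≢ (f-mono m<n))
  ... | tri≈ _ m≡n _ = m≡n
  ... | tri> _ _ n<m = contradiction (sym fm≡fn) (<⇒≢ (f-mono n<m))

module _ {A B C : Set} {f : A → C} {g : B → C} where

  [,]-injective : Injective _≡_ _≡_ f → Injective _≡_ _≡_ g →
                  (∀ x y → ¬ f x ≡ g y) → Injective _≡_ _≡_ [ f , g ]′
  [,]-injective f-inj g-inj disjoint {inj₁ x} {inj₁ x′} eq = cong inj₁ (f-inj eq)
  [,]-injective f-inj g-inj disjoint {inj₁ x} {inj₂ y}  eq = contradiction eq (disjoint x y)
  [,]-injective f-inj g-inj disjoint {inj₂ y} {inj₁ x}  eq = contradiction (sym eq) (disjoint x y)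
  [,]-injective f-inj g-inj disjoint {inj₂ y} {inj₂ y′} eq = cong inj₂ (g-inj eq)

splitAt-injective : ∀ a {b} → Injective _≡_ _≡_ (splitAt a {b})
splitAt-injective a {b} {x} {y} eq = begin
  x                      ≡⟨ sym (join-splitAt a b x) ⟩
  join a b (splitAt a x) ≡⟨ cong (join a b) eq ⟩
  join a b (splitAt a y) ≡⟨ join-splitAt a b y ⟩
  y                      ∎
  where open ≡-Reasoning

injective-bounded⇒≤ : ∀ {n m} (f : Fin n → ℕ) → Injective _≡_ _≡_ f →
                      (∀ x → f x < m) → n ≤ m
injective-bounded⇒≤ f f-inj f<m =
  injective⇒≤ (f-inj ∘ fromℕ<-injective (f _) (f _) (f<m _) (f<m _))

disjoint-injections⇒+≤ : ∀ {a b m} (f : Fin a → ℕ) (g : Fin b → ℕ) →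
  Injective _≡_ _≡_ f → Injective _≡_ _≡_ g → (∀ x y → ¬ f x ≡ g y) →
  (∀ x → f x < m) → (∀ y → g y < m) → a + b ≤ m
disjoint-injections⇒+≤ {a} f g f-inj g-inj disjoint f<m g<m =
  injective-bounded⇒≤ ([ f , g ]′ ∘ splitAt a)
    (splitAt-injective a ∘ [,]-injective f-inj g-inj disjoint)
    (λ k → [,]-bounded (splitAt a k))
  where
  [,]-bounded : ∀ k → [ f , g ]′ k < _
  [,]-bounded (inj₁ x) = f<m x
  [,]-bounded (inj₂ y) = g<m y

module _ {Λ : ℕ → Set} {e : ℕ → ℕ} (E : IsEnumeration Λ e) where
  open IsEnumeration E

  enumeration-next≤ : ∀ {i n} → Λ n → e i < n → e (suc i) ≤ n
  enumeration-next≤ {n = n} n∈Λ ei<n with onto n n∈Λ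
  ... | j , refl = <-mono⇒≤-mono increasing (<-mono⇒cancel-< increasing ei<n)

  e[i]+1∈Λ⇒e[1+i]≡e[i]+1 : ∀ i → Λ (e i + 1) → e (suc i) ≡ e i + 1
  e[i]+1∈Λ⇒e[1+i]≡e[i]+1 i ei+1∈Λ = ≤-antisym
    (enumeration-next≤ ei+1∈Λ (m<m+n (e i) z<s))
    (≤-trans (≤-reflexive (+-comm (e i) 1)) (increasing (n<1+n i)))

module _ {Λ : ℕ → Set} (S : IsNumericalSemigroup Λ)
         {e : ℕ → ℕ} (E : IsEnumeration Λ e) where
  open IsEnumeration E

  e[i]+1∉Λ⇒i+i≤e[i] : ∀ i → ¬ Λ (e i + 1) → i + i ≤ e i
  e[i]+1∉Λ⇒i+i≤e[i] i gap = s≤s⁻¹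
    (disjoint-injections⇒+≤ below reflected below-injective reflected-injective
       disjoint below-bounded reflected-bounded)
    where
    below : Fin (suc i) → ℕ
    below x = e (toℕ x)

    reflected : Fin i → ℕ
    reflected y = e i + 1 ∸ e (suc (toℕ y))

    e-injective : Injective _≡_ _≡_ e
    e-injective = <-mono⇒injective increasing

    e[1+y]≤e[i]+1 : ∀ y → e (suc (toℕ y)) ≤ e i + 1
    e[1+y]≤e[i]+1 y = m≤n⇒m≤n+o 1 (<-mono⇒≤-mono increasing (toℕ<n y))

    below-injective : Injective _≡_ _≡_ below
    below-injective = toℕ-injective ∘ e-injective

    reflected-injective : Injective _≡_ _≡_ reflected
    reflected-injective {y} {y′} =
      toℕ-injective ∘ suc-injective ∘ e-injective
        ∘ ∸-cancelˡ-≡ (e[1+y]≤e[i]+1 y) (e[1+y]≤e[i]+1 y′)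

    disjoint : ∀ x y → ¬ below x ≡ reflected y
    disjoint x y eq = gap (subst Λ sum≡ (+-closed (into _) (into _)))
      where
      open IsNumericalSemigroup S using (+-closed)
      sum≡ : below x + e (suc (toℕ y)) ≡ e i + 1
      sum≡ = trans (cong (_+ e (suc (toℕ y))) eq) (m∸n+n≡m (e[1+y]≤e[i]+1 y))

    below-bounded : ∀ x → below x < suc (e i)
    below-bounded x = s≤s (<-mono⇒≤-mono increasing (s≤s⁻¹ (toℕ<n x)))

    reflected-bounded : ∀ y → reflected y < suc (e i)
    reflected-bounded y = <-≤-trans
      (∸-monoʳ-< (≤-<-trans z≤n (increasing z<s)) (e[1+y]≤e[i]+1 y))
      (≤-reflexive (+-comm (e i) 1))

mainTheorem4 : (Λ : ℕ → Set) → IsNumericalSemigroup Λ →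
    (e : ℕ → ℕ) → IsEnumeration Λ e →
    (i : ℕ) → partialGenus e i < i → e (suc i) ≡ e i + 1
mainTheorem4 Λ S e E i g<i with e (suc i) ≟ e i + 1
... | yes next = next
... | no ¬next = contradiction i≤g (<⇒≱ g<i)
  where
  gap : ¬ Λ (e i + 1)
  gap = ¬next ∘ e[i]+1∈Λ⇒e[1+i]≡e[i]+1 E i

  i≤g : i ≤ partialGenus e i
  i≤g = m+n≤o⇒m≤o∸n i (e[i]+1∉Λ⇒i+i≤e[i] S E i gap)
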